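{- For every $n\ge 1$, \[\sum_{\sigma\in B_n} sign(\sigma)\, q^{nmaj_N(\sigma)}=(q;-q)_n\,[n]_{\pm q}!.\]
   Context: $B_n$ is the group of bijections $\sigma$ of $[-n,n]\setminus\{0\}$ with $\sigma(-a)=-\sigma(a)$, written $\sigma=[\sigma(1),\dots,\sigma(n)]$. $N$ is the natural order $-n<\dots<-1<1<\dots<n$; $maj_N(\sigma)=\sum\{i\in[1,n-1]:\sigma(i)>\sigma(i+1)\}$. $nsum(\sigma)=-\sum_{i:\sigma(i)<0}\sigma(i)$ and $nmaj_N(\sigma)=maj_N(\sigma)+nsum(\sigma)$. The length $\ell(\sigma)$ is the Coxeter length w.r.t. $s_0=[-1,2,\dots,n]$ and the adjacent transpositions $s_i$ ($1\le i\le n-1$); equivalently $\ell(\sigma)=|\{i<j:\sigma(i)>\sigma(j)\}|+nsum(\sigma)$. $sign(\sigma)=(-1)^{\ell(\sigma)}$. Notation: $[k]_x=\frac{1-x^k}{1-x}$, $[n]_{\pm x}!=[1]_x[2]_{ -x}[3]_x\cdots[n]_{(-1)^{n-1}x}$, $(a;x)_n=\prod_{k=0}^{n-1}(1-ax^k)$. -}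

module Defs where

open import Data.Nat as ℕ using (ℕ; zero; suc)
open import Data.Integer as ℤ using (ℤ; +_; -[1+_]; -_; _*_; _+_; _-_; _<?_; ∣_∣)
open import Data.List using (List; []; _∷_; map; concatMap; filter; foldr; length; applyUpTo)
import Data.Nat.ListAction as NL
open import Data.Bool using (Bool; true; false; if_then_else_)
open import Relation.Nullary.Decidable using (does)
open import Data.List.Relation.Unary.Unique.Propositional using (Unique)
open import Data.List.Relation.Unary.Unique.DecPropositional ℕ._≟_ using (unique?)

-- Signed permutations of B_n in window notation [σ(1),…,σ(n)],
-- as lists of nonzero integers.

letters : ℕ → List ℤ
letters n = applyUpTo (λ i → - (+ suc i)) n Data.List.++ applyUpTo (λ i → + suc i) n

words : List ℤ → ℕ → List (List ℤ)
words L zero = [] ∷ []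
words L (suc k) = concatMap (λ a → map (a ∷_) (words L k)) L

-- B_n : words of length n over ±[1,n] whose absolute values are pairwise
-- distinct (i.e. i ↦ |σ(i)| is a permutation of [1,n]); σ(-a) = -σ(a) then
-- defines the bijection of [-n,n]∖{0}.
Bn : ℕ → List (List ℤ)
Bn n = filter (λ w → unique? (map ∣_∣ w)) (words (letters n) n)

_>ᵇ_ : ℤ → ℤ → Bool
a >ᵇ b = does (b <? a)

-- maj_N: sum of positions i (1-indexed) with w_i > w_{i+1}
majFrom : ℕ → List ℤ → ℕ
majFrom i [] = 0
majFrom i (a ∷ []) = 0
majFrom i (a ∷ b ∷ w) = (if a >ᵇ b then i else 0) ℕ.+ majFrom (suc i) (b ∷ w)

maj : List ℤ → ℕ
maj = majFrom 1

negPart : ℤ → ℕ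
negPart (+ _) = 0
negPart -[1+ m ] = suc m

nsum : List ℤ → ℕ
nsum w = NL.sum (map negPart w)

nmaj : List ℤ → ℕ
nmaj w = maj w ℕ.+ nsum w

inv : List ℤ → ℕ
inv [] = 0
inv (a ∷ w) = length (filter (λ b → b <? a) w) ℕ.+ inv w

-- Coxeter length ℓ(σ) = inv(σ) + nsum(σ)
len : List ℤ → ℕ
len w = inv w ℕ.+ nsum w

sgnPow : ℕ → ℤ
sgnPow zero = + 1
sgnPow (suc k) = - sgnPow k

sign : List ℤ → ℤ
sign w = sgnPow (len w)

sumℤ : List ℤ → ℤ
sumℤ = foldr _+_ (+ 0)

prodℤ : List ℤ → ℤ
prodℤ = foldr _*_ (+ 1)

_^_ : ℤ → ℕ → ℤ
x ^ zero = + 1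
x ^ suc k = x * (x ^ k)

qint : ℕ → ℤ → ℤ
qint k x = sumℤ (applyUpTo (λ i → x ^ i) k)

-- [n]_{±x}! = [1]_x [2]_{-x} [3]_x ⋯ [n]_{(-1)^{n-1} x}
qfactPM : ℕ → ℤ → ℤ
qfactPM n x = prodℤ (applyUpTo (λ i → qint (suc i) (sgnPow i * x)) n)

qPoch : ℤ → ℤ → ℕ → ℤ
qPoch a x n = prodℤ (applyUpTo (λ k → + 1 - a * (x ^ k)) n)

lhs : ℕ → ℤ → ℤ
lhs n q = sumℤ (map (λ w → sign w * (q ^ nmaj w)) (Bn n))

{-# OPTIONS --safe #-}

-- Choosing a sign for each absolute value splits B_n into the orderings of the 2^n signings V of
-- {1,…,n}.  The factor (-1)^nsum q^nsum of the weight is ∏_{x ∈ V} (-q)^{negPart x}, the same for all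
-- orderings of V; summed over all signings it gives ∏_{m=1}^{n} (1 + (-q)^m) = (q;-q)_n.  The remaining
-- factor (-1)^inv q^maj sums to [n]_{±q}! over the orderings of any V.  This is proved by stripping the
-- last letter, which forces a stronger statement: for a decreasing V of size k and a letter v, the
-- orderings w of V give Σ_w wt(w v) = wt(v) ∏_{x ∈ V} (-q)^{negPart x} ((-1)^k q)^c [k]_{±q}!, where c
-- counts the letters of V above v.  In the induction step the last letter u of w, of rank i in V, adds
-- a descent at position k exactly when i < c, and Σ_{i<k} y^{i + k[i<c]} = y^c [k]_y for
-- y = (-1)^{k-1} q because y^k = q^k; the c inversions created by v turn y^c into ((-1)^k q)^c.

module Submission where

open import Defs
open import Data.Nat using (ℕ; _≥_)
open import Data.Integer using (ℤ; -_; _*_)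
open import Relation.Binary.PropositionalEquality using (_≡_)

open import Data.Bool using (Bool; true; false; _∧_; not; if_then_else_)
open import Data.Integer as ℤ using (+_; -[1+_]; +[1+_]; _+_; _-_; ∣_∣; _<_; _>_; _<?_)
open import Data.Integer.Instances
import Data.Integer.Properties as ℤᵖ
open import Data.Integer.Tactic.RingSolver using (solve-∀)
open import Data.List using (List; []; _∷_; _++_; _∷ʳ_; [_]; map; concatMap; applyUpTo; filter; length; downFrom)
import Data.List.Properties as Listᵖ
open import Data.List.Membership.Propositional using (_∈_; _∉_)
open import Data.List.Membership.Propositional.Properties using (∈-downFrom⁻)
open import Data.List.Relation.Binary.Permutation.Propositional as ↭
  using (_↭_; ↭-refl; ↭-prep; ↭-swap; ↭-sym; ↭-trans; ↭-reflexive; module PermutationReasoning)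
open import Data.List.Relation.Binary.Permutation.Propositional.Properties
  using (↭-length; filter-↭; ++⁺ʳ; ∷↭∷ʳ)
open import Data.List.Relation.Unary.All as All using (All; []; _∷_)
import Data.List.Relation.Unary.All.Properties as All
open import Data.List.Relation.Unary.AllPairs as AllPairs using (AllPairs; []; _∷_)
import Data.List.Relation.Unary.AllPairs.Properties as AllPairs
open import Data.List.Relation.Unary.Any using (here; there)
open import Data.List.Relation.Unary.Unique.Propositional using (Unique)
open import Data.List.Relation.Unary.Unique.Propositional.Properties using (Unique[x∷xs]⇒x∉xs; downFrom⁺)
open import Data.Nat as ℕ using (zero; suc; _<ᵇ_)
open import Data.Nat.Instances
import Data.Nat.ListAction as ℕ
import Data.Nat.ListAction.Properties as ℕ
import Data.Nat.Properties as ℕᵖ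
import Data.Nat.Tactic.RingSolver as ℕ-Solver
open import Data.List.Relation.Unary.Unique.DecPropositional ℕ._≟_ using (unique?)
open import Data.Product using (_×_; _,_; proj₁; proj₂)
open import Function using (_∘_; _$_; mk⇔)
open import Relation.Binary.PropositionalEquality
  using (_≢_; refl; sym; trans; cong; cong₂; subst; module ≡-Reasoning)
open import Relation.Binary.Structures using (IsDecEquivalence)
open import Relation.Binary.TypeClasses using (_≟_)
open import Relation.Nullary.Decidable using (Dec; does; yes; no; ¬?; does-⇔; dec-true; dec-false)
open import Relation.Unary using (Decidable)

-- Sums and products

variable
  A B : Set

infix 5 ∑ ∑< ∏

∑ : List A → (A → ℤ) → ℤ
∑ xs f = sumℤ (map f xs)

syntax ∑ xs (λ x → e) = ∑[ x ← xs ] e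

∑< : ℕ → (ℕ → ℤ) → ℤ
∑< n f = sumℤ (applyUpTo f n)

syntax ∑< n (λ i → e) = ∑[ i < n ] e

∏ : List A → (A → ℤ) → ℤ
∏ xs f = prodℤ (map f xs)

syntax ∏ xs (λ x → e) = ∏[ x ← xs ] e

⟦_⟧ : Bool → ℤ
⟦ true ⟧ = + 1
⟦ false ⟧ = + 0

⟦∧⟧-* : ∀ a b x → ⟦ a ∧ b ⟧ * x ≡ ⟦ a ⟧ * (⟦ b ⟧ * x)
⟦∧⟧-* true b x = sym (ℤᵖ.*-identityˡ (⟦ b ⟧ * x))
⟦∧⟧-* false b x = refl

∑-cong-∈ : (xs : List A) {f g : A → ℤ} → (∀ {x} → x ∈ xs → f x ≡ g x) → ∑ xs f ≡ ∑ xs g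
∑-cong-∈ [] eq = refl
∑-cong-∈ (x ∷ xs) eq = cong₂ _+_ (eq (here refl)) (∑-cong-∈ xs (eq ∘ there))

∑-cong : (xs : List A) {f g : A → ℤ} → (∀ x → f x ≡ g x) → ∑ xs f ≡ ∑ xs g
∑-cong xs eq = ∑-cong-∈ xs (λ {x} _ → eq x)

∑-++ : (xs ys : List A) (f : A → ℤ) → ∑ (xs ++ ys) f ≡ ∑ xs f + ∑ ys f
∑-++ [] ys f = sym (ℤᵖ.+-identityˡ _)
∑-++ (x ∷ xs) ys f = trans (cong (_+_ (f x)) (∑-++ xs ys f)) (sym (ℤᵖ.+-assoc (f x) _ _))

∑-map : (g : A → B) (xs : List A) (f : B → ℤ) → ∑ (map g xs) f ≡ ∑ xs (f ∘ g)
∑-map g xs f = cong sumℤ (sym (Listᵖ.map-∘ xs))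

∑-concatMap : (g : A → List B) (xs : List A) (f : B → ℤ) → ∑ (concatMap g xs) f ≡ ∑[ x ← xs ] ∑ (g x) f
∑-concatMap g [] f = refl
∑-concatMap g (x ∷ xs) f = trans (∑-++ (g x) _ f) (cong (_+_ (∑ (g x) f)) (∑-concatMap g xs f))

∑-+ : (xs : List A) (f g : A → ℤ) → ∑[ x ← xs ] (f x + g x) ≡ ∑ xs f + ∑ xs g
∑-+ [] f g = refl
∑-+ (x ∷ xs) f g = trans (cong (_+_ (f x + g x)) (∑-+ xs f g)) (medial (f x) (g x) _ _)
  where
  medial : ∀ a b c d → (a + b) + (c + d) ≡ (a + c) + (b + d)
  medial = solve-∀

∑-*ˡ : (c : ℤ) (xs : List A) (f : A → ℤ) → ∑[ x ← xs ] c * f x ≡ c * ∑ xs f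
∑-*ˡ c [] f = sym (ℤᵖ.*-zeroʳ c)
∑-*ˡ c (x ∷ xs) f = trans (cong (_+_ (c * f x)) (∑-*ˡ c xs f)) (sym (ℤᵖ.*-distribˡ-+ c (f x) _))

∑-*ʳ : (c : ℤ) (xs : List A) (f : A → ℤ) → ∑[ x ← xs ] f x * c ≡ ∑ xs f * c
∑-*ʳ c xs f = begin
  ∑[ x ← xs ] f x * c   ≡⟨ ∑-cong xs (λ x → ℤᵖ.*-comm (f x) c) ⟩
  ∑[ x ← xs ] c * f x   ≡⟨ ∑-*ˡ c xs f ⟩
  c * ∑ xs f            ≡⟨ ℤᵖ.*-comm c (∑ xs f) ⟩
  ∑ xs f * c            ∎
  where open ≡-Reasoning

∑-zero : (xs : List A) → ∑[ _ ← xs ] + 0 ≡ + 0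
∑-zero [] = refl
∑-zero (x ∷ xs) = trans (ℤᵖ.+-identityˡ _) (∑-zero xs)

∑-comm : (xs : List A) (ys : List B) (f : A → B → ℤ) →
  ∑[ x ← xs ] ∑[ y ← ys ] f x y ≡ ∑[ y ← ys ] ∑[ x ← xs ] f x y
∑-comm [] ys f = sym (∑-zero ys)
∑-comm (x ∷ xs) ys f =
  trans (cong (_+_ (∑ ys (f x))) (∑-comm xs ys f)) (sym (∑-+ ys (f x) (λ y → ∑[ x ← xs ] f x y)))

∑-filter : {P : A → Set} (P? : Decidable P) (xs : List A) (f : A → ℤ) →
  ∑ (filter P? xs) f ≡ ∑[ x ← xs ] ⟦ does (P? x) ⟧ * f x
∑-filter P? [] f = refl
∑-filter P? (x ∷ xs) f with does (P? x)
... | true = cong₂ _+_ (sym (ℤᵖ.*-identityˡ (f x))) (∑-filter P? xs f)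
... | false = trans (∑-filter P? xs f) (sym (ℤᵖ.+-identityˡ _))

∑<-+ : (a b : ℕ) (f : ℕ → ℤ) → ∑< (a ℕ.+ b) f ≡ ∑< a f + (∑[ i < b ] f (a ℕ.+ i))
∑<-+ zero b f = sym (ℤᵖ.+-identityˡ _)
∑<-+ (suc a) b f = trans (cong (_+_ (f 0)) (∑<-+ a b (f ∘ suc))) (sym (ℤᵖ.+-assoc (f 0) _ _))

∑<-cong : (n : ℕ) {f g : ℕ → ℤ} → (∀ i → i ℕ.< n → f i ≡ g i) → ∑< n f ≡ ∑< n g
∑<-cong zero eq = refl
∑<-cong (suc n) eq = cong₂ _+_ (eq 0 ℕ.z<s) (∑<-cong n (λ i i<n → eq (suc i) (ℕ.s<s i<n)))

∑<-*ˡ : (c : ℤ) (n : ℕ) (f : ℕ → ℤ) → ∑[ i < n ] c * f i ≡ c * ∑< n f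
∑<-*ˡ c zero f = sym (ℤᵖ.*-zeroʳ c)
∑<-*ˡ c (suc n) f = trans (cong (_+_ (c * f 0)) (∑<-*ˡ c n (f ∘ suc))) (sym (ℤᵖ.*-distribˡ-+ c (f 0) _))

∏-↭ : {xs ys : List A} (f : A → ℤ) → xs ↭ ys → ∏ xs f ≡ ∏ ys f
∏-↭ f ↭.refl = refl
∏-↭ f (↭.prep x p) = cong (f x *_) (∏-↭ f p)
∏-↭ f (↭.swap x y p) = trans (cong (λ P → f x * (f y * P)) (∏-↭ f p)) (left-comm (f x) (f y) _)
  where
  left-comm : ∀ a b c → a * (b * c) ≡ b * (a * c)
  left-comm = solve-∀
∏-↭ f (↭.trans p p′) = trans (∏-↭ f p) (∏-↭ f p′)

prodℤ-applyUpTo-suc : (n : ℕ) (g : ℕ → ℤ) → prodℤ (applyUpTo g (suc n)) ≡ prodℤ (applyUpTo g n) * g n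
prodℤ-applyUpTo-suc zero g = ℤᵖ.*-comm (g 0) (+ 1)
prodℤ-applyUpTo-suc (suc n) g =
  trans (cong (g 0 *_) (prodℤ-applyUpTo-suc n (g ∘ suc))) (sym (ℤᵖ.*-assoc (g 0) _ _))

∏-downFrom : (n : ℕ) (g : ℕ → ℤ) → ∏ (downFrom n) g ≡ prodℤ (applyUpTo g n)
∏-downFrom zero g = refl
∏-downFrom (suc n) g = trans (cong (g n *_) (∏-downFrom n g))
  (trans (ℤᵖ.*-comm (g n) _) (sym (prodℤ-applyUpTo-suc n g)))

^-+ : (x : ℤ) (a b : ℕ) → x ^ (a ℕ.+ b) ≡ x ^ a * x ^ b
^-+ x zero b = sym (ℤᵖ.*-identityˡ (x ^ b))
^-+ x (suc a) b = trans (cong (x *_) (^-+ x a b)) (sym (ℤᵖ.*-assoc x (x ^ a) (x ^ b)))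

*-^ : (x y : ℤ) (n : ℕ) → (x * y) ^ n ≡ x ^ n * y ^ n
*-^ x y zero = refl
*-^ x y (suc n) = trans (cong (x * y *_) (*-^ x y n)) (exchange x y (x ^ n) (y ^ n))
  where
  exchange : ∀ a b c d → (a * b) * (c * d) ≡ (a * c) * (b * d)
  exchange = solve-∀

sgnPow-+ : (a b : ℕ) → sgnPow (a ℕ.+ b) ≡ sgnPow a * sgnPow b
sgnPow-+ zero b = sym (ℤᵖ.*-identityˡ (sgnPow b))
sgnPow-+ (suc a) b = trans (cong -_ (sgnPow-+ a b)) (ℤᵖ.neg-distribˡ-* (sgnPow a) (sgnPow b))

sgnPow-* : (x : ℤ) (n : ℕ) → sgnPow n * x ^ n ≡ (- x) ^ n
sgnPow-* x zero = refl
sgnPow-* x (suc n) = trans (neg-exchange (sgnPow n) x (x ^ n)) (cong (- x *_) (sgnPow-* x n))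
  where
  neg-exchange : ∀ s a p → (- s) * (a * p) ≡ (- a) * (s * p)
  neg-exchange = solve-∀

sgnPow-^ : (a n : ℕ) → sgnPow a ^ n ≡ sgnPow (a ℕ.* n)
sgnPow-^ a zero = cong sgnPow (sym (ℕᵖ.*-zeroʳ a))
sgnPow-^ a (suc n) = begin
  sgnPow a * sgnPow a ^ n       ≡⟨ cong (sgnPow a *_) (sgnPow-^ a n) ⟩
  sgnPow a * sgnPow (a ℕ.* n)   ≡⟨ sgnPow-+ a (a ℕ.* n) ⟨
  sgnPow (a ℕ.+ a ℕ.* n)        ≡⟨ cong sgnPow (ℕᵖ.*-suc a n) ⟨
  sgnPow (a ℕ.* suc n)          ∎
  where open ≡-Reasoning

sgnPow-double : (a : ℕ) → sgnPow (a ℕ.+ a) ≡ + 1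
sgnPow-double zero = refl
sgnPow-double (suc a) = trans (cong (-_ ∘ sgnPow) (ℕᵖ.+-suc a a)) (trans (ℤᵖ.neg-involutive _) (sgnPow-double a))

sgnPow-pronic : (a : ℕ) → sgnPow (a ℕ.* suc a) ≡ + 1
sgnPow-pronic zero = refl
sgnPow-pronic (suc a) = begin
  sgnPow (suc a ℕ.* suc (suc a))                      ≡⟨ cong sgnPow (pronic-suc a) ⟩
  sgnPow (a ℕ.* suc a ℕ.+ (suc a ℕ.+ suc a))          ≡⟨ sgnPow-+ (a ℕ.* suc a) _ ⟩
  sgnPow (a ℕ.* suc a) * sgnPow (suc a ℕ.+ suc a)     ≡⟨ cong₂ _*_ (sgnPow-pronic a) (sgnPow-double (suc a)) ⟩
  + 1                                                 ∎
  where
  open ≡-Reasoning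
  pronic-suc : ∀ a → suc a ℕ.* suc (suc a) ≡ a ℕ.* suc a ℕ.+ (suc a ℕ.+ suc a)
  pronic-suc = ℕ-Solver.solve-∀

-- Removing an element; arrangements

module _ {A : Set} {{_ : IsDecEquivalence {A = A} _≡_}} where

  infixl 6 _∖_

  _∖_ : List A → A → List A
  xs ∖ x = filter (λ y → ¬? (y ≟ x)) xs

  ∉⇒≢ : {x y : A} {xs : List A} → x ∉ xs → y ∈ xs → x ≢ y
  ∉⇒≢ x∉xs y∈xs refl = x∉xs y∈xs

  ∷-∖-≢ : {x y : A} (xs : List A) → y ≢ x → (y ∷ xs) ∖ x ≡ y ∷ xs ∖ x
  ∷-∖-≢ {x} xs = Listᵖ.filter-accept (λ y → ¬? (y ≟ x))

  ∷-∖-≡ : (x : A) (xs : List A) → (x ∷ xs) ∖ x ≡ xs ∖ x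
  ∷-∖-≡ x xs = Listᵖ.filter-reject (λ y → ¬? (y ≟ x)) (_$ refl)

  ∖-∉ : {x : A} (xs : List A) → x ∉ xs → xs ∖ x ≡ xs
  ∖-∉ {x} xs x∉xs =
    Listᵖ.filter-all (λ y → ¬? (y ≟ x)) (All.tabulate (λ y∈xs → ∉⇒≢ x∉xs y∈xs ∘ sym))

  ∷-∖-fresh : {x : A} (xs : List A) → x ∉ xs → (x ∷ xs) ∖ x ≡ xs
  ∷-∖-fresh {x} xs x∉xs = trans (∷-∖-≡ x xs) (∖-∉ xs x∉xs)

  ∖-comm : (xs : List A) (x y : A) → xs ∖ x ∖ y ≡ xs ∖ y ∖ x
  ∖-comm [] x y = refl
  ∖-comm (z ∷ xs) x y = by-cases (z ≟ x) (z ≟ y)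
    where
    by-cases : Dec (z ≡ x) → Dec (z ≡ y) → (z ∷ xs) ∖ x ∖ y ≡ (z ∷ xs) ∖ y ∖ x
    by-cases (yes refl) (yes refl) = refl
    by-cases (yes refl) (no z≢y) = begin
      (z ∷ xs) ∖ z ∖ y   ≡⟨ cong (_∖ y) (∷-∖-≡ z xs) ⟩
      xs ∖ z ∖ y         ≡⟨ ∖-comm xs z y ⟩
      xs ∖ y ∖ z         ≡⟨ ∷-∖-≡ z (xs ∖ y) ⟨
      (z ∷ xs ∖ y) ∖ z   ≡⟨ cong (_∖ z) (∷-∖-≢ xs z≢y) ⟨
      (z ∷ xs) ∖ y ∖ z   ∎
      where open ≡-Reasoning
    by-cases (no z≢x) (yes refl) = begin
      (z ∷ xs) ∖ x ∖ z   ≡⟨ cong (_∖ z) (∷-∖-≢ xs z≢x) ⟩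
      (z ∷ xs ∖ x) ∖ z   ≡⟨ ∷-∖-≡ z (xs ∖ x) ⟩
      xs ∖ x ∖ z         ≡⟨ ∖-comm xs x z ⟩
      xs ∖ z ∖ x         ≡⟨ cong (_∖ x) (∷-∖-≡ z xs) ⟨
      (z ∷ xs) ∖ z ∖ x   ∎
      where open ≡-Reasoning
    by-cases (no z≢x) (no z≢y) = begin
      (z ∷ xs) ∖ x ∖ y   ≡⟨ cong (_∖ y) (∷-∖-≢ xs z≢x) ⟩
      (z ∷ xs ∖ x) ∖ y   ≡⟨ ∷-∖-≢ (xs ∖ x) z≢y ⟩
      z ∷ xs ∖ x ∖ y     ≡⟨ cong (z ∷_) (∖-comm xs x y) ⟩
      z ∷ xs ∖ y ∖ x     ≡⟨ ∷-∖-≢ (xs ∖ y) z≢x ⟨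
      (z ∷ xs ∖ y) ∖ x   ≡⟨ cong (_∖ x) (∷-∖-≢ xs z≢y) ⟨
      (z ∷ xs) ∖ y ∖ x   ∎
      where open ≡-Reasoning

  ++-∖ : (xs ys : List A) (x : A) → (xs ++ ys) ∖ x ≡ xs ∖ x ++ ys ∖ x
  ++-∖ xs ys x = Listᵖ.filter-++ (λ y → ¬? (y ≟ x)) xs ys

  AllPairs-∖ : {R : A → A → Set} {xs : List A} (x : A) → AllPairs R xs → AllPairs R (xs ∖ x)
  AllPairs-∖ x = AllPairs.filter⁺ (λ y → ¬? (y ≟ x))

  ↭-∖ : {x : A} {xs : List A} → Unique xs → x ∈ xs → xs ↭ x ∷ xs ∖ x
  ↭-∖ {xs = x ∷ xs} u@(_ ∷ _) (here refl) =
    ↭-reflexive (cong (x ∷_) (sym (∷-∖-fresh xs (Unique[x∷xs]⇒x∉xs u))))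
  ↭-∖ {x} {y ∷ xs} (y≢xs ∷ u) (there x∈xs) = begin
    y ∷ xs              ↭⟨ ↭-prep y (↭-∖ u x∈xs) ⟩
    y ∷ x ∷ xs ∖ x      ↭⟨ ↭-swap y x ↭-refl ⟩
    x ∷ y ∷ xs ∖ x      ≡⟨ cong (x ∷_) (∷-∖-≢ xs y≢x) ⟨
    x ∷ (y ∷ xs) ∖ x    ∎
    where
    open PermutationReasoning
    y≢x : y ≢ x
    y≢x = All.lookup y≢xs x∈xs

  length-∖ : {x : A} {xs : List A} {k : ℕ} → Unique xs → x ∈ xs →
    length xs ≡ suc k → length (xs ∖ x) ≡ k
  length-∖ u x∈xs |xs|≡1+k = ℕᵖ.suc-injective (trans (sym (↭-length (↭-∖ u x∈xs))) |xs|≡1+k)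

  ∑-∖-comm : (xs : List A) (f : A → A → ℤ) →
    ∑[ x ← xs ] ∑[ y ← xs ∖ x ] f x y ≡ ∑[ y ← xs ] ∑[ x ← xs ∖ y ] f x y
  ∑-∖-comm xs f = begin
    ∑[ x ← xs ] ∑[ y ← xs ∖ x ] f x y
      ≡⟨ ∑-cong xs (λ x → ∑-filter _ xs (f x)) ⟩
    ∑[ x ← xs ] ∑[ y ← xs ] ⟦ not (does (y ≟ x)) ⟧ * f x y
      ≡⟨ ∑-comm xs xs _ ⟩
    ∑[ y ← xs ] ∑[ x ← xs ] ⟦ not (does (y ≟ x)) ⟧ * f x y
      ≡⟨ ∑-cong xs (λ y → ∑-cong xs (λ x → cong (λ b → ⟦ not b ⟧ * f x y) (does-sym y x))) ⟩
    ∑[ y ← xs ] ∑[ x ← xs ] ⟦ not (does (x ≟ y)) ⟧ * f x y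
      ≡⟨ ∑-cong xs (λ y → ∑-filter _ xs (λ x → f x y)) ⟨
    ∑[ y ← xs ] ∑[ x ← xs ∖ y ] f x y
      ∎
    where
    open ≡-Reasoning
    does-sym : (x y : A) → does (x ≟ y) ≡ does (y ≟ x)
    does-sym x y = does-⇔ (mk⇔ sym sym) (x ≟ y) (y ≟ x)

  arrangements : ℕ → List A → List (List A)
  arrangements zero V = [] ∷ []
  arrangements (suc k) V = concatMap (λ v → map (v ∷_) (arrangements k (V ∖ v))) V

  ∑-arrangements-suc : (k : ℕ) (V : List A) (F : List A → ℤ) →
    ∑ (arrangements (suc k) V) F ≡ ∑[ v ← V ] ∑[ w ← arrangements k (V ∖ v) ] F (v ∷ w)
  ∑-arrangements-suc k V F =
    trans (∑-concatMap _ V F) (∑-cong V (λ v → ∑-map (v ∷_) (arrangements k (V ∖ v)) F))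

  ∑-arrangements-∷ʳ : (k : ℕ) (V : List A) (F : List A → ℤ) →
    ∑ (arrangements (suc k) V) F ≡ ∑[ v ← V ] ∑[ w ← arrangements k (V ∖ v) ] F (w ∷ʳ v)
  ∑-arrangements-∷ʳ zero V F = ∑-arrangements-suc zero V F
  ∑-arrangements-∷ʳ (suc k) V F = begin
    ∑ (arrangements (suc (suc k)) V) F
      ≡⟨ ∑-arrangements-suc (suc k) V F ⟩
    ∑[ a ← V ] ∑[ w ← arrangements (suc k) (V ∖ a) ] F (a ∷ w)
      ≡⟨ ∑-cong V (λ a → ∑-arrangements-∷ʳ k (V ∖ a) (F ∘ (a ∷_))) ⟩
    ∑[ a ← V ] ∑[ v ← V ∖ a ] ∑[ w ← arrangements k (V ∖ a ∖ v) ] F (a ∷ (w ∷ʳ v))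
      ≡⟨ ∑-cong V (λ a → ∑-cong (V ∖ a) (λ v →
           cong (λ U → ∑[ w ← arrangements k U ] F (a ∷ (w ∷ʳ v))) (∖-comm V a v))) ⟩
    ∑[ a ← V ] ∑[ v ← V ∖ a ] ∑[ w ← arrangements k (V ∖ v ∖ a) ] F (a ∷ (w ∷ʳ v))
      ≡⟨ ∑-∖-comm V _ ⟩
    ∑[ v ← V ] ∑[ a ← V ∖ v ] ∑[ w ← arrangements k (V ∖ v ∖ a) ] F (a ∷ (w ∷ʳ v))
      ≡⟨ ∑-cong V (λ v → ∑-arrangements-suc k (V ∖ v) (λ w → F (w ∷ʳ v))) ⟨
    ∑[ v ← V ] ∑[ w ← arrangements (suc k) (V ∖ v) ] F (w ∷ʳ v)
      ∎
    where open ≡-Reasoning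

  ∑-arrangements-symmetric-* : (h : List A → ℤ) → (∀ {w w′} → w ↭ w′ → h w ≡ h w′) →
    (k : ℕ) (V : List A) → Unique V → length V ≡ k → (F : List A → ℤ) →
    ∑[ w ← arrangements k V ] h w * F w ≡ h V * ∑ (arrangements k V) F
  ∑-arrangements-symmetric-* h h-↭ zero [] _ _ F = ∑-*ˡ (h []) ([] ∷ []) F
  ∑-arrangements-symmetric-* h h-↭ (suc k) V u |V|≡1+k F = begin
    ∑[ w ← arrangements (suc k) V ] h w * F w
      ≡⟨ ∑-arrangements-suc k V _ ⟩
    ∑[ v ← V ] ∑[ w ← arrangements k (V ∖ v) ] h (v ∷ w) * F (v ∷ w)
      ≡⟨ ∑-cong-∈ V pull ⟩
    ∑[ v ← V ] h V * (∑[ w ← arrangements k (V ∖ v) ] F (v ∷ w))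
      ≡⟨ ∑-*ˡ (h V) V _ ⟩
    h V * (∑[ v ← V ] ∑[ w ← arrangements k (V ∖ v) ] F (v ∷ w))
      ≡⟨ cong (h V *_) (∑-arrangements-suc k V F) ⟨
    h V * ∑ (arrangements (suc k) V) F
      ∎
    where
    open ≡-Reasoning
    pull : ∀ {v} → v ∈ V →
      ∑[ w ← arrangements k (V ∖ v) ] h (v ∷ w) * F (v ∷ w) ≡
      h V * (∑[ w ← arrangements k (V ∖ v) ] F (v ∷ w))
    pull {v} v∈V = trans
      (∑-arrangements-symmetric-* (h ∘ (v ∷_)) (h-↭ ∘ ↭-prep v) k (V ∖ v) (AllPairs-∖ v u)
        (length-∖ u v∈V |V|≡1+k) (F ∘ (v ∷_)))
      (cong (_* _) (h-↭ (↭-sym (↭-∖ u v∈V))))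

  ∑-∷-∖ : {x : A} (V : List A) (g : A → List A → ℤ) → x ∉ V →
    ∑[ v ← x ∷ V ] g v ((x ∷ V) ∖ v) ≡ g x V + (∑[ v ← V ] g v (x ∷ V ∖ v))
  ∑-∷-∖ {x} V g x∉V =
    cong₂ _+_ (cong (g x) (∷-∖-fresh V x∉V)) (∑-cong-∈ V (cong (g _) ∘ ∷-∖-≢ V ∘ ∉⇒≢ x∉V))

  ∑-∷ʳ-∖ : {x : A} (V : List A) (g : A → List A → ℤ) → x ∉ V →
    ∑[ v ← V ∷ʳ x ] g v ((V ∷ʳ x) ∖ v) ≡ (∑[ v ← V ] g v (V ∖ v ∷ʳ x)) + g x V
  ∑-∷ʳ-∖ {x} V g x∉V = begin
    ∑[ v ← V ∷ʳ x ] g v ((V ∷ʳ x) ∖ v)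
      ≡⟨ ∑-++ V (x ∷ []) _ ⟩
    (∑[ v ← V ] g v ((V ∷ʳ x) ∖ v)) + (g x ((V ∷ʳ x) ∖ x) + + 0)
      ≡⟨ cong₂ _+_ (∑-cong-∈ V (cong (g _) ∘ ∷ʳ-∖-≢ ∘ ∉⇒≢ x∉V)) (ℤᵖ.+-identityʳ _) ⟩
    (∑[ v ← V ] g v (V ∖ v ∷ʳ x)) + g x ((V ∷ʳ x) ∖ x)
      ≡⟨ cong (_+_ (∑[ v ← V ] g v (V ∖ v ∷ʳ x)) ∘ g x) ∷ʳ-∖-self ⟩
    (∑[ v ← V ] g v (V ∖ v ∷ʳ x)) + g x V
      ∎
    where
    open ≡-Reasoning
    ∷ʳ-∖-≢ : ∀ {v} → x ≢ v → (V ∷ʳ x) ∖ v ≡ V ∖ v ∷ʳ x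
    ∷ʳ-∖-≢ x≢v = trans (++-∖ V (x ∷ []) _) (cong (V ∖ _ ++_) (∷-∖-≢ [] x≢v))
    ∷ʳ-∖-self : (V ∷ʳ x) ∖ x ≡ V
    ∷ʳ-∖-self = trans (++-∖ V (x ∷ []) x)
      (trans (cong₂ _++_ (∖-∉ V x∉V) (∷-∖-≡ x [])) (Listᵖ.++-identityʳ V))

-- Signed words

-- m ∈ A stands for the absolute value m + 1.
±letters : List ℕ → List ℤ
±letters [] = []
±letters (m ∷ A) = +[1+ m ] ∷ -[1+ m ] ∷ ±letters A

-- A signing of A picks one of ±(m + 1) for each m ∈ A.  The positive letter goes in front and the
-- negative one at the back, so that the signings of a decreasing A are decreasing.
signings : List ℕ → List (List ℤ)
signings [] = [] ∷ []
signings (m ∷ A) = map (+[1+ m ] ∷_) (signings A) ++ map (_∷ʳ -[1+ m ]) (signings A)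

∑-±letters : (A : List ℕ) (h : ℤ → ℤ) → ∑ (±letters A) h ≡ ∑[ m ← A ] (h +[1+ m ] + h -[1+ m ])
∑-±letters [] h = refl
∑-±letters (m ∷ A) h =
  trans (cong (_+_ (h +[1+ m ]) ∘ _+_ (h -[1+ m ])) (∑-±letters A h))
        (sym (ℤᵖ.+-assoc (h +[1+ m ]) (h -[1+ m ]) _))

filter-±letters : (m : ℕ) (A : List ℕ) →
  filter (λ x → ¬? (suc m ℕ.≟ ∣ x ∣)) (±letters A) ≡ ±letters (A ∖ m)
filter-±letters m [] = refl
filter-±letters m (y ∷ A) = by-cases (y ℕ.≟ m)
  where
  P? = λ x → ¬? (suc m ℕ.≟ ∣ x ∣)
  by-cases : Dec (y ≡ m) → filter P? (±letters (y ∷ A)) ≡ ±letters ((y ∷ A) ∖ m)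
  by-cases (yes refl) = begin
    filter P? (+[1+ m ] ∷ -[1+ m ] ∷ ±letters A)  ≡⟨ Listᵖ.filter-reject P? {+[1+ m ]} (_$ refl) ⟩
    filter P? (-[1+ m ] ∷ ±letters A)             ≡⟨ Listᵖ.filter-reject P? { -[1+ m ] } (_$ refl) ⟩
    filter P? (±letters A)                        ≡⟨ filter-±letters m A ⟩
    ±letters (A ∖ m)                              ≡⟨ cong ±letters (∷-∖-≡ m A) ⟨
    ±letters ((m ∷ A) ∖ m)                        ∎
    where open ≡-Reasoning
  by-cases (no y≢m) = begin
    filter P? (+[1+ y ] ∷ -[1+ y ] ∷ ±letters A)
      ≡⟨ Listᵖ.filter-accept P? {+[1+ y ]} m≢y ⟩
    +[1+ y ] ∷ filter P? (-[1+ y ] ∷ ±letters A)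
      ≡⟨ cong (+[1+ y ] ∷_) (Listᵖ.filter-accept P? { -[1+ y ] } m≢y) ⟩
    +[1+ y ] ∷ -[1+ y ] ∷ filter P? (±letters A)
      ≡⟨ cong (λ L → +[1+ y ] ∷ -[1+ y ] ∷ L) (filter-±letters m A) ⟩
    ±letters (y ∷ A ∖ m)
      ≡⟨ cong ±letters (∷-∖-≢ A y≢m) ⟨
    ±letters ((y ∷ A) ∖ m)
      ∎
    where
    open ≡-Reasoning
    m≢y : suc m ≢ suc y
    m≢y = y≢m ∘ sym ∘ ℕᵖ.suc-injective

∑-signings-∷ : (a : ℕ) (A : List ℕ) (f : List ℤ → ℤ) →
  ∑ (signings (a ∷ A)) f ≡ ∑[ V ← signings A ] (f (+[1+ a ] ∷ V) + f (V ∷ʳ -[1+ a ]))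
∑-signings-∷ a A f = begin
  ∑ (map (+[1+ a ] ∷_) (signings A) ++ map (_∷ʳ -[1+ a ]) (signings A)) f
    ≡⟨ ∑-++ (map (+[1+ a ] ∷_) (signings A)) _ f ⟩
  ∑ (map (+[1+ a ] ∷_) (signings A)) f + ∑ (map (_∷ʳ -[1+ a ]) (signings A)) f
    ≡⟨ cong₂ _+_ (∑-map (+[1+ a ] ∷_) (signings A) f) (∑-map (_∷ʳ -[1+ a ]) (signings A) f) ⟩
  (∑[ V ← signings A ] f (+[1+ a ] ∷ V)) + (∑[ V ← signings A ] f (V ∷ʳ -[1+ a ]))
    ≡⟨ ∑-+ (signings A) _ _ ⟨
  ∑[ V ← signings A ] (f (+[1+ a ] ∷ V) + f (V ∷ʳ -[1+ a ]))
    ∎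
  where open ≡-Reasoning

signings-abs : (A : List ℕ) → All (All (λ x → ℕ.pred ∣ x ∣ ∈ A)) (signings A)
signings-abs [] = [] ∷ []
signings-abs (a ∷ A) = All.++⁺
  (All.map⁺ (All.map (λ absV → here refl ∷ All.map there absV) (signings-abs A)))
  (All.map⁺ (All.map (λ absV → All.∷ʳ⁺ (All.map there absV) (here refl)) (signings-abs A)))

-- A signing V of A with a letter v ∈ V is the same as m ∈ A, a sign, and the signing V ∖ v of A ∖ m.
∑-signings-∑-∖ : (A : List ℕ) → Unique A → (g : ℤ → List ℤ → ℤ) →
  ∑[ V ← signings A ] ∑[ v ← V ] g v (V ∖ v) ≡
  ∑[ m ← A ] ∑[ V ← signings (A ∖ m) ] (g +[1+ m ] V + g -[1+ m ] V)
∑-signings-∑-∖ [] [] g = refl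
∑-signings-∑-∖ (a ∷ A) u@(a≢A ∷ uA) g = begin
  ∑ (signings (a ∷ A)) (Φ g)
    ≡⟨ ∑-signings-∷ a A (Φ g) ⟩
  ∑[ V ← signings A ] (Φ g (+[1+ a ] ∷ V) + Φ g (V ∷ʳ -[1+ a ]))
    ≡⟨ ∑-cong-∈ (signings A) peel ⟩
  ∑[ V ← signings A ] ((g +[1+ a ] V + Φ g₊ V) + (Φ g₋ V + g -[1+ a ] V))
    ≡⟨ ∑-cong (signings A) (λ V → medial (g +[1+ a ] V) _ _ _) ⟩
  ∑[ V ← signings A ] (G g a V + (Φ g₊ V + Φ g₋ V))
    ≡⟨ ∑-+ (signings A) (G g a) _ ⟩
  ∑ (signings A) (G g a) + (∑[ V ← signings A ] (Φ g₊ V + Φ g₋ V))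
    ≡⟨ cong₂ _+_ (cong (λ A′ → ∑ (signings A′) (G g a)) (sym (∷-∖-fresh A (Unique[x∷xs]⇒x∉xs u))))
                 (trans (∑-+ (signings A) (Φ g₊) (Φ g₋))
                        (cong₂ _+_ (∑-signings-∑-∖ A uA g₊) (∑-signings-∑-∖ A uA g₋))) ⟩
  ∑ (signings ((a ∷ A) ∖ a)) (G g a) + (∑ A (G′ g₊) + ∑ A (G′ g₋))
    ≡⟨ cong (_+_ (∑ (signings ((a ∷ A) ∖ a)) (G g a)))
            (trans (sym (∑-+ A (G′ g₊) (G′ g₋))) (∑-cong-∈ A glue)) ⟩
  ∑ (signings ((a ∷ A) ∖ a)) (G g a) + (∑[ m ← A ] ∑ (signings ((a ∷ A) ∖ m)) (G g m))
    ∎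
  where
  open ≡-Reasoning
  Φ : (ℤ → List ℤ → ℤ) → List ℤ → ℤ
  Φ h V = ∑[ v ← V ] h v (V ∖ v)
  G : (ℤ → List ℤ → ℤ) → ℕ → List ℤ → ℤ
  G h m V = h +[1+ m ] V + h -[1+ m ] V
  G′ : (ℤ → List ℤ → ℤ) → ℕ → ℤ
  G′ h m = ∑ (signings (A ∖ m)) (G h m)
  g₊ g₋ : ℤ → List ℤ → ℤ
  g₊ v W = g v (+[1+ a ] ∷ W)
  g₋ v W = g v (W ∷ʳ -[1+ a ])
  medial : ∀ p φ ψ n → (p + φ) + (ψ + n) ≡ (p + n) + (φ + ψ)
  medial = solve-∀
  fresh : ∀ {V x} → V ∈ signings A → ∣ x ∣ ≡ suc a → x ∉ V
  fresh V∈ |x|≡1+a x∈V =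
    All.lookup a≢A (All.lookup (All.lookup (signings-abs A) V∈) x∈V) (cong ℕ.pred (sym |x|≡1+a))
  peel : ∀ {V} → V ∈ signings A →
    Φ g (+[1+ a ] ∷ V) + Φ g (V ∷ʳ -[1+ a ]) ≡ (g +[1+ a ] V + Φ g₊ V) + (Φ g₋ V + g -[1+ a ] V)
  peel V∈ = cong₂ _+_ (∑-∷-∖ _ g (fresh V∈ refl)) (∑-∷ʳ-∖ _ g (fresh V∈ refl))
  glue : ∀ {m} → m ∈ A → G′ g₊ m + G′ g₋ m ≡ ∑ (signings ((a ∷ A) ∖ m)) (G g m)
  glue {m} m∈A = begin
    G′ g₊ m + G′ g₋ m
      ≡⟨ ∑-+ (signings (A ∖ m)) (G g₊ m) (G g₋ m) ⟨
    ∑[ V ← signings (A ∖ m) ] (G g m (+[1+ a ] ∷ V) + G g m (V ∷ʳ -[1+ a ]))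
      ≡⟨ ∑-signings-∷ a (A ∖ m) (G g m) ⟨
    ∑ (signings (a ∷ A ∖ m)) (G g m)
      ≡⟨ cong (λ A′ → ∑ (signings A′) (G g m)) (∷-∖-≢ A (All.lookup a≢A m∈A)) ⟨
    ∑ (signings ((a ∷ A) ∖ m)) (G g m)
      ∎

∑-words-suc : (L : List ℤ) (k : ℕ) (F : List ℤ → ℤ) →
  ∑ (words L (suc k)) F ≡ ∑[ a ← L ] ∑[ w ← words L k ] F (a ∷ w)
∑-words-suc L k F = trans (∑-concatMap _ L F) (∑-cong L (λ a → ∑-map (a ∷_) (words L k) F))

∑-words-all : {P : ℤ → Set} (P? : Decidable P) (L : List ℤ) (k : ℕ) (F : List ℤ → ℤ) →
  ∑[ w ← words L k ] ⟦ does (All.all? P? w) ⟧ * F w ≡ ∑ (words (filter P? L) k) F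
∑-words-all P? L zero F = cong (_+ + 0) (ℤᵖ.*-identityˡ (F []))
∑-words-all P? L (suc k) F = begin
  ∑[ w ← words L (suc k) ] ⟦ does (All.all? P? w) ⟧ * F w
    ≡⟨ ∑-words-suc L k _ ⟩
  ∑[ a ← L ] ∑[ w ← words L k ] ⟦ does (P? a) ∧ does (All.all? P? w) ⟧ * F (a ∷ w)
    ≡⟨ ∑-cong L (λ a → ∑-cong (words L k) (λ w → ⟦∧⟧-* (does (P? a)) _ _)) ⟩
  ∑[ a ← L ] ∑[ w ← words L k ] ⟦ does (P? a) ⟧ * (⟦ does (All.all? P? w) ⟧ * F (a ∷ w))
    ≡⟨ ∑-cong L (λ a → ∑-*ˡ ⟦ does (P? a) ⟧ (words L k) _) ⟩
  ∑[ a ← L ] ⟦ does (P? a) ⟧ * (∑[ w ← words L k ] ⟦ does (All.all? P? w) ⟧ * F (a ∷ w))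
    ≡⟨ ∑-cong L (λ a → cong (⟦ does (P? a) ⟧ *_) (∑-words-all P? L k (F ∘ (a ∷_)))) ⟩
  ∑[ a ← L ] ⟦ does (P? a) ⟧ * ∑ (words (filter P? L) k) (F ∘ (a ∷_))
    ≡⟨ ∑-filter P? L _ ⟨
  ∑[ a ← filter P? L ] ∑ (words (filter P? L) k) (F ∘ (a ∷_))
    ≡⟨ ∑-words-suc (filter P? L) k F ⟨
  ∑ (words (filter P? L) (suc k)) F
    ∎
  where
  open ≡-Reasoning

uniqueAbs : List ℤ → Bool
uniqueAbs w = does (unique? (map ∣_∣ w))

∑-words-uniqueAbs-suc : (L : List ℤ) (k : ℕ) (F : List ℤ → ℤ) →
  ∑[ w ← words L (suc k) ] ⟦ uniqueAbs w ⟧ * F w ≡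
  ∑[ a ← L ] ∑[ w ← words (filter (λ x → ¬? (∣ a ∣ ℕ.≟ ∣ x ∣)) L) k ] ⟦ uniqueAbs w ⟧ * F (a ∷ w)
∑-words-uniqueAbs-suc L k F = trans (∑-words-suc L k _) (∑-cong L λ a → begin
  ∑[ w ← words L k ] ⟦ uniqueAbs (a ∷ w) ⟧ * F (a ∷ w)
    ≡⟨ ∑-cong (words L k) (λ w → cong (λ b → ⟦ b ∧ uniqueAbs w ⟧ * F (a ∷ w)) (fresh-map a w)) ⟩
  ∑[ w ← words L k ] ⟦ does (All.all? (P? a) w) ∧ uniqueAbs w ⟧ * F (a ∷ w)
    ≡⟨ ∑-cong (words L k) (λ w → ⟦∧⟧-* (does (All.all? (P? a) w)) (uniqueAbs w) (F (a ∷ w))) ⟩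
  ∑[ w ← words L k ] ⟦ does (All.all? (P? a) w) ⟧ * (⟦ uniqueAbs w ⟧ * F (a ∷ w))
    ≡⟨ ∑-words-all (P? a) L k _ ⟩
  ∑[ w ← words (filter (P? a) L) k ] ⟦ uniqueAbs w ⟧ * F (a ∷ w)
    ∎)
  where
  open ≡-Reasoning
  P? : (a x : ℤ) → Dec (∣ a ∣ ≢ ∣ x ∣)
  P? a x = ¬? (∣ a ∣ ℕ.≟ ∣ x ∣)
  fresh-map : ∀ a w → does (All.all? (λ y → ¬? (∣ a ∣ ℕ.≟ y)) (map ∣_∣ w)) ≡ does (All.all? (P? a) w)
  fresh-map a w = does-⇔ (mk⇔ All.map⁻ All.map⁺) (All.all? _ (map ∣_∣ w)) (All.all? (P? a) w)

∑-words-uniqueAbs : (k : ℕ) (A : List ℕ) → Unique A → length A ≡ k → (F : List ℤ → ℤ) →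
  ∑[ w ← words (±letters A) k ] ⟦ uniqueAbs w ⟧ * F w ≡ ∑[ V ← signings A ] ∑ (arrangements k V) F
∑-words-uniqueAbs zero [] _ _ F = cong (_+ + 0) (trans (ℤᵖ.*-identityˡ (F [])) (sym (ℤᵖ.+-identityʳ (F []))))
∑-words-uniqueAbs (suc k) A u |A|≡1+k F = begin
  ∑[ w ← words (±letters A) (suc k) ] ⟦ uniqueAbs w ⟧ * F w
    ≡⟨ ∑-words-uniqueAbs-suc (±letters A) k F ⟩
  ∑ (±letters A) S
    ≡⟨ ∑-±letters A S ⟩
  ∑[ m ← A ] (S +[1+ m ] + S -[1+ m ])
    ≡⟨ ∑-cong-∈ A (λ {m} m∈A → cong₂ _+_ (remove-abs m∈A +[1+ m ]) (remove-abs m∈A -[1+ m ])) ⟩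
  ∑[ m ← A ] ((∑[ V ← signings (A ∖ m) ] g +[1+ m ] V) + (∑[ V ← signings (A ∖ m) ] g -[1+ m ] V))
    ≡⟨ ∑-cong A (λ m → ∑-+ (signings (A ∖ m)) (g +[1+ m ]) (g -[1+ m ])) ⟨
  ∑[ m ← A ] ∑[ V ← signings (A ∖ m) ] (g +[1+ m ] V + g -[1+ m ] V)
    ≡⟨ ∑-signings-∑-∖ A u g ⟨
  ∑[ V ← signings A ] ∑[ v ← V ] g v (V ∖ v)
    ≡⟨ ∑-cong (signings A) (λ V → ∑-arrangements-suc k V F) ⟨
  ∑[ V ← signings A ] ∑ (arrangements (suc k) V) F
    ∎
  where
  open ≡-Reasoning
  S : ℤ → ℤ
  S a = ∑[ w ← words (filter (λ x → ¬? (∣ a ∣ ℕ.≟ ∣ x ∣)) (±letters A)) k ] ⟦ uniqueAbs w ⟧ * F (a ∷ w)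
  g : ℤ → List ℤ → ℤ
  g v V = ∑[ w ← arrangements k V ] F (v ∷ w)
  remove-abs : ∀ {m} → m ∈ A → (a : ℤ) →
    ∑[ w ← words (filter (λ x → ¬? (suc m ℕ.≟ ∣ x ∣)) (±letters A)) k ] ⟦ uniqueAbs w ⟧ * F (a ∷ w) ≡
    ∑[ V ← signings (A ∖ m) ] g a V
  remove-abs {m} m∈A a = trans
    (cong (λ L → ∑[ w ← words L k ] ⟦ uniqueAbs w ⟧ * F (a ∷ w)) (filter-±letters m A))
    (∑-words-uniqueAbs k (A ∖ m) (AllPairs-∖ m u)
      (length-∖ u m∈A |A|≡1+k) (F ∘ (a ∷_)))

∑-words-cong : (L L′ : List ℤ) → (∀ h → ∑ L h ≡ ∑ L′ h) → (k : ℕ) (G : List ℤ → ℤ) →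
  ∑ (words L k) G ≡ ∑ (words L′ k) G
∑-words-cong L L′ L≈L′ zero G = refl
∑-words-cong L L′ L≈L′ (suc k) G = begin
  ∑ (words L (suc k)) G                          ≡⟨ ∑-words-suc L k G ⟩
  ∑[ a ← L ] ∑[ w ← words L k ] G (a ∷ w)        ≡⟨ ∑-cong L (λ a → ∑-words-cong L L′ L≈L′ k _) ⟩
  ∑[ a ← L ] ∑[ w ← words L′ k ] G (a ∷ w)       ≡⟨ L≈L′ _ ⟩
  ∑[ a ← L′ ] ∑[ w ← words L′ k ] G (a ∷ w)      ≡⟨ ∑-words-suc L′ k G ⟨
  ∑ (words L′ (suc k)) G                         ∎
  where open ≡-Reasoning

∑-applyUpTo : (f : ℕ → ℤ) (n : ℕ) (h : ℤ → ℤ) → ∑ (applyUpTo f n) h ≡ ∑[ m ← downFrom n ] h (f m)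
∑-applyUpTo f zero h = refl
∑-applyUpTo f (suc n) h = begin
  ∑ (applyUpTo f (suc n)) h                   ≡⟨ cong (λ xs → ∑ xs h) (Listᵖ.applyUpTo-∷ʳ f n) ⟨
  ∑ (applyUpTo f n ++ [ f n ]) h              ≡⟨ ∑-++ (applyUpTo f n) [ f n ] h ⟩
  ∑ (applyUpTo f n) h + (h (f n) + + 0)       ≡⟨ cong₂ _+_ (∑-applyUpTo f n h) (ℤᵖ.+-identityʳ (h (f n))) ⟩
  (∑[ m ← downFrom n ] h (f m)) + h (f n)     ≡⟨ ℤᵖ.+-comm _ (h (f n)) ⟩
  ∑[ m ← downFrom (suc n) ] h (f m)           ∎
  where open ≡-Reasoning

∑-letters : (n : ℕ) (h : ℤ → ℤ) → ∑ (letters n) h ≡ ∑ (±letters (downFrom n)) h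
∑-letters n h = begin
  ∑ (letters n) h
    ≡⟨ ∑-++ (applyUpTo -[1+_] n) (applyUpTo +[1+_] n) h ⟩
  ∑ (applyUpTo -[1+_] n) h + ∑ (applyUpTo +[1+_] n) h
    ≡⟨ cong₂ _+_ (∑-applyUpTo -[1+_] n h) (∑-applyUpTo +[1+_] n h) ⟩
  (∑[ m ← downFrom n ] h -[1+ m ]) + (∑[ m ← downFrom n ] h +[1+ m ])
    ≡⟨ ℤᵖ.+-comm (∑[ m ← downFrom n ] h -[1+ m ]) _ ⟩
  (∑[ m ← downFrom n ] h +[1+ m ]) + (∑[ m ← downFrom n ] h -[1+ m ])
    ≡⟨ ∑-+ (downFrom n) (h ∘ +[1+_]) (h ∘ -[1+_]) ⟨
  ∑[ m ← downFrom n ] (h +[1+ m ] + h -[1+ m ])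
    ≡⟨ ∑-±letters (downFrom n) h ⟨
  ∑ (±letters (downFrom n)) h
    ∎
  where open ≡-Reasoning

∑-signings-∏ : (A : List ℕ) (f : ℤ → ℤ) →
  ∑[ V ← signings A ] ∏ V f ≡ ∏[ m ← A ] (f +[1+ m ] + f -[1+ m ])
∑-signings-∏ [] f = refl
∑-signings-∏ (a ∷ A) f = begin
  ∑ (signings (a ∷ A)) (λ V → ∏ V f)
    ≡⟨ ∑-signings-∷ a A (λ V → ∏ V f) ⟩
  ∑[ V ← signings A ] (f +[1+ a ] * ∏ V f + ∏ (V ∷ʳ -[1+ a ]) f)
    ≡⟨ ∑-cong (signings A) (λ V →
         cong (_+_ (f +[1+ a ] * ∏ V f)) (∏-↭ f (↭-sym (∷↭∷ʳ -[1+ a ] V)))) ⟩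
  ∑[ V ← signings A ] (f +[1+ a ] * ∏ V f + f -[1+ a ] * ∏ V f)
    ≡⟨ ∑-cong (signings A) (λ V → ℤᵖ.*-distribʳ-+ (∏ V f) (f +[1+ a ]) (f -[1+ a ])) ⟨
  ∑[ V ← signings A ] (f +[1+ a ] + f -[1+ a ]) * ∏ V f
    ≡⟨ ∑-*ˡ (f +[1+ a ] + f -[1+ a ]) (signings A) (λ V → ∏ V f) ⟩
  (f +[1+ a ] + f -[1+ a ]) * (∑[ V ← signings A ] ∏ V f)
    ≡⟨ cong ((f +[1+ a ] + f -[1+ a ]) *_) (∑-signings-∏ A f) ⟩
  ∏[ m ← a ∷ A ] (f +[1+ m ] + f -[1+ m ])
    ∎
  where open ≡-Reasoning

signings-length : (A : List ℕ) → All (λ V → length V ≡ length A) (signings A)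
signings-length [] = refl ∷ []
signings-length (a ∷ A) = All.++⁺
  (All.map⁺ (All.map (cong suc) (signings-length A)))
  (All.map⁺ (All.map (λ {V} |V|≡|A| → trans (length-∷ʳ V) (cong suc |V|≡|A|)) (signings-length A)))
  where
  length-∷ʳ : (V : List ℤ) → length (V ∷ʳ -[1+ a ]) ≡ suc (length V)
  length-∷ʳ V = trans (Listᵖ.length-++ V) (ℕᵖ.+-comm (length V) 1)

-- Appending a letter

countAbove : ℤ → List ℤ → ℕ
countAbove v w = length (filter (v <?_) w)

length-filter-++ : {P : ℤ → Set} (P? : Decidable P) (xs ys : List ℤ) →
  length (filter P? (xs ++ ys)) ≡ length (filter P? xs) ℕ.+ length (filter P? ys)
length-filter-++ P? xs ys = trans (cong length (Listᵖ.filter-++ P? xs ys)) (Listᵖ.length-++ (filter P? xs))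

inv-∷ʳ : (w : List ℤ) (v : ℤ) → inv (w ∷ʳ v) ≡ inv w ℕ.+ countAbove v w
inv-∷ʳ [] v = refl
inv-∷ʳ (a ∷ w) v = begin
  length (filter (_<? a) (w ∷ʳ v)) ℕ.+ inv (w ∷ʳ v)
    ≡⟨ cong₂ ℕ._+_ (length-filter-++ (_<? a) w [ v ]) (inv-∷ʳ w v) ⟩
  (length (filter (_<? a) w) ℕ.+ length (filter (_<? a) [ v ])) ℕ.+ (inv w ℕ.+ countAbove v w)
    ≡⟨ cong (λ n → (length (filter (_<? a) w) ℕ.+ n) ℕ.+ (inv w ℕ.+ countAbove v w)) below≡above ⟩
  (length (filter (_<? a) w) ℕ.+ length (filter (v <?_) [ a ])) ℕ.+ (inv w ℕ.+ countAbove v w)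
    ≡⟨ medial (length (filter (_<? a) w)) _ (inv w) _ ⟩
  (length (filter (_<? a) w) ℕ.+ inv w) ℕ.+ (length (filter (v <?_) [ a ]) ℕ.+ countAbove v w)
    ≡⟨ cong (inv (a ∷ w) ℕ.+_) (length-filter-++ (v <?_) [ a ] w) ⟨
  inv (a ∷ w) ℕ.+ countAbove v (a ∷ w)
    ∎
  where
  open ≡-Reasoning
  below≡above : length (filter (_<? a) [ v ]) ≡ length (filter (v <?_) [ a ])
  below≡above with does (v <? a)
  ... | true = refl
  ... | false = refl
  medial : ∀ b c i d → (b ℕ.+ c) ℕ.+ (i ℕ.+ d) ≡ (b ℕ.+ i) ℕ.+ (c ℕ.+ d)
  medial = ℕ-Solver.solve-∀

nsum-∷ʳ : (w : List ℤ) (v : ℤ) → nsum (w ∷ʳ v) ≡ nsum w ℕ.+ negPart v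
nsum-∷ʳ w v = begin
  ℕ.sum (map negPart (w ∷ʳ v))                     ≡⟨ cong ℕ.sum (Listᵖ.map-++ negPart w [ v ]) ⟩
  ℕ.sum (map negPart w ++ [ negPart v ])           ≡⟨ ℕ.sum-++ (map negPart w) [ negPart v ] ⟩
  nsum w ℕ.+ (negPart v ℕ.+ 0)                     ≡⟨ cong (nsum w ℕ.+_) (ℕᵖ.+-identityʳ (negPart v)) ⟩
  nsum w ℕ.+ negPart v                             ∎
  where open ≡-Reasoning

majFrom-∷ʳ-∷ʳ : (i : ℕ) (w : List ℤ) (u v : ℤ) →
  majFrom i (w ∷ʳ u ∷ʳ v) ≡ majFrom i (w ∷ʳ u) ℕ.+ (if u >ᵇ v then i ℕ.+ length w else 0)
majFrom-∷ʳ-∷ʳ i [] u v with u >ᵇ v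
... | true = refl
... | false = refl
majFrom-∷ʳ-∷ʳ i (a ∷ []) u v with u >ᵇ v
... | true = shift (if a >ᵇ u then i else 0) i
  where
  shift : ∀ d i → d ℕ.+ (suc i ℕ.+ 0) ≡ (d ℕ.+ 0) ℕ.+ (i ℕ.+ 1)
  shift = ℕ-Solver.solve-∀
... | false = sym (ℕᵖ.+-identityʳ _)
majFrom-∷ʳ-∷ʳ i (a ∷ b ∷ w) u v = begin
  d ℕ.+ majFrom (suc i) (b ∷ w ∷ʳ u ∷ʳ v)
    ≡⟨ cong (d ℕ.+_) (majFrom-∷ʳ-∷ʳ (suc i) (b ∷ w) u v) ⟩
  d ℕ.+ (majFrom (suc i) (b ∷ w ∷ʳ u) ℕ.+ (if u >ᵇ v then suc i ℕ.+ length (b ∷ w) else 0))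
    ≡⟨ ℕᵖ.+-assoc d _ _ ⟨
  majFrom i (a ∷ b ∷ w ∷ʳ u) ℕ.+ (if u >ᵇ v then suc i ℕ.+ length (b ∷ w) else 0)
    ≡⟨ cong (λ n → majFrom i (a ∷ b ∷ w ∷ʳ u) ℕ.+ (if u >ᵇ v then n else 0))
            (ℕᵖ.+-suc i (length (b ∷ w))) ⟨
  majFrom i (a ∷ b ∷ w ∷ʳ u) ℕ.+ (if u >ᵇ v then i ℕ.+ length (a ∷ b ∷ w) else 0)
    ∎
  where
  open ≡-Reasoning
  d = if a >ᵇ b then i else 0

countAbove-↭ : (v : ℤ) {w w′ : List ℤ} → w ↭ w′ → countAbove v w ≡ countAbove v w′
countAbove-↭ v p = ↭-length (filter-↭ (v <?_) p)

Decreasing : List ℤ → Set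
Decreasing = AllPairs _>_

Decreasing⇒Unique : {V : List ℤ} → Decreasing V → Unique V
Decreasing⇒Unique = AllPairs.map (λ y<x → ℤᵖ.<⇒≢ y<x ∘ sym)

-- The i-th letter of a decreasing V has rank i and lies above v iff i < countAbove v V.
∑-rank : (V : List ℤ) → Decreasing V → (v : ℤ) (H : Bool → ℕ → ℤ) →
  ∑[ u ← V ] H (does (v <? u)) (countAbove u (V ∖ u)) ≡ ∑[ i < length V ] H (i <ᵇ countAbove v V) i
∑-rank [] [] v H = refl
∑-rank (x ∷ xs) (x>xs ∷ dec) v H = begin
  H (does (v <? x)) (countAbove x ((x ∷ xs) ∖ x)) +
  (∑[ u ← xs ] H (does (v <? u)) (countAbove u ((x ∷ xs) ∖ u)))
    ≡⟨ cong₂ _+_ (cong (H (does (v <? x))) top-rank) (∑-cong-∈ xs (cong (H _) ∘ lower-rank)) ⟩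
  H (does (v <? x)) 0 + (∑[ u ← xs ] H (does (v <? u)) (suc (countAbove u (xs ∖ u))))
    ≡⟨ cong (_+_ (H (does (v <? x)) 0)) (∑-rank xs dec v (λ b → H b ∘ suc)) ⟩
  H (does (v <? x)) 0 + (∑[ i < length xs ] H (i <ᵇ countAbove v xs) (suc i))
    ≡⟨ by-cases (v <? x) ⟩
  ∑[ i < length (x ∷ xs) ] H (i <ᵇ countAbove v (x ∷ xs)) i
    ∎
  where
  open ≡-Reasoning
  top-rank : countAbove x ((x ∷ xs) ∖ x) ≡ 0
  top-rank = trans (cong (countAbove x) (∷-∖-fresh xs (Unique[x∷xs]⇒x∉xs (Decreasing⇒Unique (x>xs ∷ dec)))))
                   (cong length (Listᵖ.filter-none (x <?_) (All.map ℤᵖ.<-asym x>xs)))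
  lower-rank : ∀ {u} → u ∈ xs → countAbove u ((x ∷ xs) ∖ u) ≡ suc (countAbove u (xs ∖ u))
  lower-rank u∈xs =
    cong length (trans (cong (filter (_ <?_)) (∷-∖-≢ xs (ℤᵖ.<⇒≢ u<x ∘ sym)))
                       (Listᵖ.filter-accept (_ <?_) u<x))
    where u<x = All.lookup x>xs u∈xs
  by-cases : Dec (v < x) →
    H (does (v <? x)) 0 + (∑[ i < length xs ] H (i <ᵇ countAbove v xs) (suc i)) ≡
    ∑[ i < length (x ∷ xs) ] H (i <ᵇ countAbove v (x ∷ xs)) i
  by-cases (yes v<x) = trans
    (cong (λ b → H b 0 + (∑[ i < length xs ] H (i <ᵇ countAbove v xs) (suc i))) (dec-true (v <? x) v<x))
    (cong (λ c → ∑[ i < length (x ∷ xs) ] H (i <ᵇ c) i) (sym (cong length (Listᵖ.filter-accept (v <?_) v<x))))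
  by-cases (no v≮x) = trans
    (cong₂ (λ b c → H b 0 + (∑[ i < length xs ] H (i <ᵇ c) (suc i))) (dec-false (v <? x) v≮x) none-above)
    (cong (λ c → ∑[ i < length (x ∷ xs) ] H (i <ᵇ c) i)
      (sym (trans (cong length (Listᵖ.filter-reject (v <?_) v≮x)) none-above)))
    where
    none-above : countAbove v xs ≡ 0
    none-above = cong length (Listᵖ.filter-none (v <?_) (All.map (λ y<x v<y → v≮x (ℤᵖ.<-trans v<y y<x)) x>xs))

<⇒<ᵇ≡true : {i c : ℕ} → i ℕ.< c → (i <ᵇ c) ≡ true
<⇒<ᵇ≡true {zero} {suc c} _ = refl
<⇒<ᵇ≡true {suc i} {suc c} (ℕ.s≤s i<c) = <⇒<ᵇ≡true i<c

+<ᵇ≡false : (c i : ℕ) → (c ℕ.+ i <ᵇ c) ≡ false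
+<ᵇ≡false zero i = refl
+<ᵇ≡false (suc c) i = +<ᵇ≡false c i

∑-rotate : (y : ℤ) {c k : ℕ} → c ℕ.≤ k →
  ∑[ i < k ] y ^ (if i <ᵇ c then k ℕ.+ i else i) ≡ y ^ c * (∑[ i < k ] y ^ i)
∑-rotate y {c} c≤k with ℕᵖ.m≤n⇒∃[o]m+o≡n c≤k
... | d , refl = begin
  ∑< (c ℕ.+ d) F
    ≡⟨ ∑<-+ c d F ⟩
  ∑< c F + (∑[ i < d ] F (c ℕ.+ i))
    ≡⟨ cong₂ _+_ (∑<-cong c (λ i i<c → cong (λ b → F′ b i) (<⇒<ᵇ≡true i<c)))
                 (∑<-cong d (λ i _ → cong (λ b → F′ b (c ℕ.+ i)) (+<ᵇ≡false c i))) ⟩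
  (∑[ i < c ] y ^ (c ℕ.+ d ℕ.+ i)) + (∑[ i < d ] y ^ (c ℕ.+ i))
    ≡⟨ cong₂ _+_ (∑<-cong c (λ i _ → trans (cong (y ^_) (ℕᵖ.+-assoc c d i)) (^-+ y c (d ℕ.+ i))))
                 (∑<-cong d (λ i _ → ^-+ y c i)) ⟩
  (∑[ i < c ] y ^ c * y ^ (d ℕ.+ i)) + (∑[ i < d ] y ^ c * y ^ i)
    ≡⟨ cong₂ _+_ (∑<-*ˡ (y ^ c) c (λ i → y ^ (d ℕ.+ i))) (∑<-*ˡ (y ^ c) d (y ^_)) ⟩
  y ^ c * (∑[ i < c ] y ^ (d ℕ.+ i)) + y ^ c * ∑< d (y ^_)
    ≡⟨ ℤᵖ.*-distribˡ-+ (y ^ c) _ _ ⟨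
  y ^ c * ((∑[ i < c ] y ^ (d ℕ.+ i)) + ∑< d (y ^_))
    ≡⟨ cong (y ^ c *_) (trans (ℤᵖ.+-comm _ (∑< d (y ^_))) (sym (∑<-+ d c (y ^_)))) ⟩
  y ^ c * ∑< (d ℕ.+ c) (y ^_)
    ≡⟨ cong (λ n → y ^ c * ∑< n (y ^_)) (ℕᵖ.+-comm d c) ⟩
  y ^ c * ∑< (c ℕ.+ d) (y ^_)
    ∎
  where
  open ≡-Reasoning
  F′ : Bool → ℕ → ℤ
  F′ b i = y ^ (if b then c ℕ.+ d ℕ.+ i else i)
  F : ℕ → ℤ
  F i = F′ (i <ᵇ c) i

signings-decreasing : (n : ℕ) → All Decreasing (signings (downFrom n))
signings-decreasing zero = [] ∷ []
signings-decreasing (suc n) = All.++⁺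
  (All.map⁺ (All.zipWith (λ (dec , bounded) → All.map proj₂ bounded ∷ dec) (signings-decreasing n , bounds)))
  (All.map⁺ (All.zipWith (λ (dec , bounded) → AllPairs.++⁺ dec ([] ∷ []) (All.map ((_∷ []) ∘ proj₁) bounded))
                         (signings-decreasing n , bounds)))
  where
  abs-bound : {x : ℤ} → ℕ.pred ∣ x ∣ ∈ downFrom n → -[1+ n ] < x × x < +[1+ n ]
  abs-bound {+ zero} _ = ℤ.-<+ , ℤ.+<+ ℕ.z<s
  abs-bound {+[1+ m ]} m∈ = ℤ.-<+ , ℤ.+<+ (ℕ.s≤s (∈-downFrom⁻ m∈))
  abs-bound { -[1+ m ] } m∈ = ℤ.-<- (∈-downFrom⁻ m∈) , ℤ.-<+
  bounds : All (All (λ x → -[1+ n ] < x × x < +[1+ n ])) (signings (downFrom n))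
  bounds = All.map (All.map abs-bound) (signings-abs (downFrom n))

-- Weights

module _ (q : ℤ) where

  wt : List ℤ → ℤ
  wt w = sign w * q ^ nmaj w

  letterWeight : ℤ → ℤ
  letterWeight x = (- q) ^ negPart x

  wt-∷ʳ : (x : List ℤ) (v : ℤ) (d : ℕ) → maj (x ∷ʳ v) ≡ maj x ℕ.+ d →
    wt (x ∷ʳ v) ≡ sgnPow (countAbove v x) * letterWeight v * q ^ d * wt x
  wt-∷ʳ x v d maj-∷ʳ = begin
    sgnPow (inv (x ∷ʳ v) ℕ.+ nsum (x ∷ʳ v)) * q ^ (maj (x ∷ʳ v) ℕ.+ nsum (x ∷ʳ v))
      ≡⟨ cong₂ (λ a b → sgnPow a * q ^ b)
           (trans (cong₂ ℕ._+_ (inv-∷ʳ x v) (nsum-∷ʳ x v)) (medial (inv x) c (nsum x) p))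
           (trans (cong₂ ℕ._+_ maj-∷ʳ (nsum-∷ʳ x v)) (medial′ (maj x) d (nsum x) p)) ⟩
    sgnPow (len x ℕ.+ (c ℕ.+ p)) * q ^ (nmaj x ℕ.+ (p ℕ.+ d))
      ≡⟨ cong₂ _*_ (sgnPow-+ (len x) (c ℕ.+ p)) (^-+ q (nmaj x) (p ℕ.+ d)) ⟩
    sign x * sgnPow (c ℕ.+ p) * (q ^ nmaj x * q ^ (p ℕ.+ d))
      ≡⟨ cong₂ (λ s t → sign x * s * (q ^ nmaj x * t)) (sgnPow-+ c p) (^-+ q p d) ⟩
    sign x * (sgnPow c * sgnPow p) * (q ^ nmaj x * (q ^ p * q ^ d))
      ≡⟨ regroup (sign x) (sgnPow c) (sgnPow p) (q ^ nmaj x) (q ^ p) (q ^ d) ⟩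
    sgnPow c * (sgnPow p * q ^ p) * q ^ d * wt x
      ≡⟨ cong (λ t → sgnPow c * t * q ^ d * wt x) (sgnPow-* q p) ⟩
    sgnPow c * letterWeight v * q ^ d * wt x
      ∎
    where
    open ≡-Reasoning
    c = countAbove v x
    p = negPart v
    medial : ∀ a b c d → (a ℕ.+ b) ℕ.+ (c ℕ.+ d) ≡ (a ℕ.+ c) ℕ.+ (b ℕ.+ d)
    medial = ℕ-Solver.solve-∀
    medial′ : ∀ a b c d → (a ℕ.+ b) ℕ.+ (c ℕ.+ d) ≡ (a ℕ.+ c) ℕ.+ (d ℕ.+ b)
    medial′ = ℕ-Solver.solve-∀
    regroup : ∀ s sc sp Q qp qd → s * (sc * sp) * (Q * (qp * qd)) ≡ sc * (sp * qp) * qd * (s * Q)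
    regroup = solve-∀

  -- altq k is the variable (-1)^k q of the (k+1)-st factor of [n]_{±q}!.
  altq : ℕ → ℤ
  altq k = sgnPow k * q

  altq-^-suc : (k : ℕ) → altq k ^ suc k ≡ q ^ suc k
  altq-^-suc k = begin
    (sgnPow k * q) ^ suc k              ≡⟨ *-^ (sgnPow k) q (suc k) ⟩
    sgnPow k ^ suc k * q ^ suc k        ≡⟨ cong (_* q ^ suc k) (trans (sgnPow-^ k (suc k)) (sgnPow-pronic k)) ⟩
    + 1 * q ^ suc k                     ≡⟨ ℤᵖ.*-identityˡ (q ^ suc k) ⟩
    q ^ suc k                           ∎
    where open ≡-Reasoning

  q^-*-altq^ : (k : ℕ) (b : Bool) (r : ℕ) →
    q ^ (if b then suc k else 0) * altq k ^ r ≡ altq k ^ (if b then suc k ℕ.+ r else r)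
  q^-*-altq^ k true r = trans (cong (_* altq k ^ r) (sym (altq-^-suc k))) (sym (^-+ (altq k) (suc k) r))
  q^-*-altq^ k false r = ℤᵖ.*-identityˡ (altq k ^ r)

  ∏-∖ : {V : List ℤ} {u : ℤ} → Unique V → u ∈ V →
    letterWeight u * ∏ (V ∖ u) letterWeight ≡ ∏ V letterWeight
  ∏-∖ uV u∈V = sym (∏-↭ letterWeight (↭-∖ uV u∈V))

  ∑-arrangements-wt-∷ʳ : (k : ℕ) (V : List ℤ) → Decreasing V → length V ≡ k → (v : ℤ) →
    ∑[ w ← arrangements k V ] wt (w ∷ʳ v) ≡
    letterWeight v * ∏ V letterWeight * altq k ^ countAbove v V * qfactPM k q
  ∑-arrangements-wt-∷ʳ zero [] [] refl v = trans (cong (_+ + 0) (wt-∷ʳ [] v 0 refl)) (normalise (letterWeight v))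
    where
    normalise : ∀ x → + 1 * x * + 1 * (+ 1 * + 1) + + 0 ≡ x * + 1 * + 1 * + 1
    normalise = solve-∀
  ∑-arrangements-wt-∷ʳ (suc k) V dec |V|≡1+k v = begin
    ∑[ w ← arrangements (suc k) V ] wt (w ∷ʳ v)
      ≡⟨ ∑-arrangements-∷ʳ k V (λ w → wt (w ∷ʳ v)) ⟩
    ∑[ u ← V ] ∑[ w ← arrangements k (V ∖ u) ] wt (w ∷ʳ u ∷ʳ v)
      ≡⟨ ∑-cong-∈ V last-two ⟩
    ∑[ u ← V ] C * H (does (v <? u)) (countAbove u (V ∖ u))
      ≡⟨ ∑-*ˡ C V _ ⟩
    C * (∑[ u ← V ] H (does (v <? u)) (countAbove u (V ∖ u)))
      ≡⟨ cong (C *_) (∑-rank V dec v H) ⟩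
    C * (∑[ i < length V ] H (i <ᵇ c) i)
      ≡⟨ cong (λ n → C * (∑[ i < n ] H (i <ᵇ c) i)) |V|≡1+k ⟩
    C * (∑[ i < suc k ] H (i <ᵇ c) i)
      ≡⟨ cong (C *_) (∑-rotate (altq k) (subst (c ℕ.≤_) |V|≡1+k (Listᵖ.length-filter (v <?_) V))) ⟩
    C * (altq k ^ c * qint (suc k) (altq k))
      ≡⟨ regroup (sgnPow c) (letterWeight v) (∏ V letterWeight) (qfactPM k q) (altq k ^ c) (qint (suc k) (altq k)) ⟩
    letterWeight v * ∏ V letterWeight * (sgnPow c * altq k ^ c) * (qfactPM k q * qint (suc k) (altq k))
      ≡⟨ cong₂ (λ a t → letterWeight v * ∏ V letterWeight * a * t)
           (trans (sgnPow-* (altq k) c) (cong (_^ c) (ℤᵖ.neg-distribˡ-* (sgnPow k) q)))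
           (sym (prodℤ-applyUpTo-suc k (λ i → qint (suc i) (altq i)))) ⟩
    letterWeight v * ∏ V letterWeight * altq (suc k) ^ c * qfactPM (suc k) q
      ∎
    where
    open ≡-Reasoning
    c = countAbove v V
    C = sgnPow c * letterWeight v * ∏ V letterWeight * qfactPM k q
    H : Bool → ℕ → ℤ
    H b r = altq k ^ (if b then suc k ℕ.+ r else r)
    regroup : ∀ s l P T y Q → s * l * P * T * (y * Q) ≡ l * P * (s * y) * (T * Q)
    regroup = solve-∀
    last-two : ∀ {u} → u ∈ V →
      ∑[ w ← arrangements k (V ∖ u) ] wt (w ∷ʳ u ∷ʳ v) ≡ C * H (does (v <? u)) (countAbove u (V ∖ u))
    last-two {u} u∈V = begin
      ∑[ w ← arrangements k R ] wt (w ∷ʳ u ∷ʳ v)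
        ≡⟨ ∑-cong (arrangements k R) (λ w → wt-∷ʳ (w ∷ʳ u) v _ (majFrom-∷ʳ-∷ʳ 1 w u v)) ⟩
      ∑[ w ← arrangements k R ] h w * wt (w ∷ʳ u)
        ≡⟨ ∑-arrangements-symmetric-* h h-↭ k R (Decreasing⇒Unique decR) |R|≡k (λ w → wt (w ∷ʳ u)) ⟩
      h R * (∑[ w ← arrangements k R ] wt (w ∷ʳ u))
        ≡⟨ cong (h R *_) (∑-arrangements-wt-∷ʳ k R decR |R|≡k u) ⟩
      h R * (letterWeight u * ∏ R letterWeight * altq k ^ r * qfactPM k q)
        ≡⟨ cong₂ (λ a n → sgnPow a * letterWeight v * q ^ (if b then suc n else 0) * IH) c-R |R|≡k ⟩
      sgnPow c * letterWeight v * D * (letterWeight u * ∏ R letterWeight * altq k ^ r * qfactPM k q)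
        ≡⟨ regroup′ (sgnPow c * letterWeight v) D (letterWeight u * ∏ R letterWeight) (altq k ^ r) (qfactPM k q) ⟩
      sgnPow c * letterWeight v * (letterWeight u * ∏ R letterWeight) * qfactPM k q * (D * altq k ^ r)
        ≡⟨ cong₂ (λ P t → sgnPow c * letterWeight v * P * qfactPM k q * t)
                 (∏-∖ uV u∈V) (q^-*-altq^ k b r) ⟩
      C * H b r
        ∎
      where
      R = V ∖ u
      r = countAbove u R
      IH = letterWeight u * ∏ R letterWeight * altq k ^ r * qfactPM k q
      b = does (v <? u)
      D = q ^ (if b then suc k else 0)
      uV = Decreasing⇒Unique dec
      decR : Decreasing R
      decR = AllPairs-∖ u dec
      |R|≡k : length R ≡ k
      |R|≡k = length-∖ uV u∈V |V|≡1+k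
      h : List ℤ → ℤ
      h w = sgnPow (countAbove v (w ∷ʳ u)) * letterWeight v * q ^ (if b then suc (length w) else 0)
      h-↭ : ∀ {w w′} → w ↭ w′ → h w ≡ h w′
      h-↭ p = cong₂ (λ a n → sgnPow a * letterWeight v * q ^ (if b then suc n else 0))
        (countAbove-↭ v (++⁺ʳ [ u ] p)) (↭-length p)
      c-R : countAbove v (R ∷ʳ u) ≡ c
      c-R = countAbove-↭ v (↭-trans (↭-sym (∷↭∷ʳ u R)) (↭-sym (↭-∖ uV u∈V)))
      regroup′ : ∀ s Q P y T → s * Q * (P * y * T) ≡ s * P * T * (Q * y)
      regroup′ = solve-∀

  ∑-arrangements-wt : (k : ℕ) (V : List ℤ) → Decreasing V → length V ≡ k →
    ∑ (arrangements k V) wt ≡ ∏ V letterWeight * qfactPM k q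
  ∑-arrangements-wt zero [] [] refl = refl
  ∑-arrangements-wt (suc k) V dec |V|≡1+k = begin
    ∑ (arrangements (suc k) V) wt
      ≡⟨ ∑-arrangements-∷ʳ k V wt ⟩
    ∑[ u ← V ] ∑[ w ← arrangements k (V ∖ u) ] wt (w ∷ʳ u)
      ≡⟨ ∑-cong-∈ V last-one ⟩
    ∑[ u ← V ] ∏ V letterWeight * qfactPM k q * altq k ^ countAbove u (V ∖ u)
      ≡⟨ ∑-*ˡ (∏ V letterWeight * qfactPM k q) V _ ⟩
    ∏ V letterWeight * qfactPM k q * (∑[ u ← V ] altq k ^ countAbove u (V ∖ u))
      ≡⟨ cong (∏ V letterWeight * qfactPM k q *_) (∑-rank V dec (+ 0) (λ _ r → altq k ^ r)) ⟩
    ∏ V letterWeight * qfactPM k q * (∑[ i < length V ] altq k ^ i)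
      ≡⟨ cong (λ n → ∏ V letterWeight * qfactPM k q * ∑< n (altq k ^_)) |V|≡1+k ⟩
    ∏ V letterWeight * qfactPM k q * qint (suc k) (altq k)
      ≡⟨ ℤᵖ.*-assoc (∏ V letterWeight) (qfactPM k q) _ ⟩
    ∏ V letterWeight * (qfactPM k q * qint (suc k) (altq k))
      ≡⟨ cong (∏ V letterWeight *_) (prodℤ-applyUpTo-suc k (λ i → qint (suc i) (altq i))) ⟨
    ∏ V letterWeight * qfactPM (suc k) q
      ∎
    where
    open ≡-Reasoning
    last-one : ∀ {u} → u ∈ V →
      ∑[ w ← arrangements k (V ∖ u) ] wt (w ∷ʳ u) ≡
      ∏ V letterWeight * qfactPM k q * altq k ^ countAbove u (V ∖ u)
    last-one {u} u∈V = begin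
      ∑[ w ← arrangements k (V ∖ u) ] wt (w ∷ʳ u)
        ≡⟨ ∑-arrangements-wt-∷ʳ k (V ∖ u) (AllPairs-∖ u dec) |R|≡k u ⟩
      letterWeight u * ∏ (V ∖ u) letterWeight * altq k ^ countAbove u (V ∖ u) * qfactPM k q
        ≡⟨ cong (λ P → P * altq k ^ countAbove u (V ∖ u) * qfactPM k q) (∏-∖ uV u∈V) ⟩
      ∏ V letterWeight * altq k ^ countAbove u (V ∖ u) * qfactPM k q
        ≡⟨ right-comm (∏ V letterWeight) _ _ ⟩
      ∏ V letterWeight * qfactPM k q * altq k ^ countAbove u (V ∖ u)
        ∎
      where
      uV = Decreasing⇒Unique dec
      |R|≡k : length (V ∖ u) ≡ k
      |R|≡k = length-∖ uV u∈V |V|≡1+k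
      right-comm : ∀ a b c → a * b * c ≡ a * c * b
      right-comm = solve-∀

  ∑-signings-letterWeight : (n : ℕ) → ∑[ V ← signings (downFrom n) ] ∏ V letterWeight ≡ qPoch q (- q) n
  ∑-signings-letterWeight n = begin
    ∑[ V ← signings (downFrom n) ] ∏ V letterWeight
      ≡⟨ ∑-signings-∏ (downFrom n) letterWeight ⟩
    ∏[ m ← downFrom n ] (+ 1 + (- q) * (- q) ^ m)
      ≡⟨ cong prodℤ (Listᵖ.map-cong (λ m → one-minus q ((- q) ^ m)) (downFrom n)) ⟩
    ∏[ m ← downFrom n ] (+ 1 - q * (- q) ^ m)
      ≡⟨ ∏-downFrom n _ ⟩
    qPoch q (- q) n
      ∎
    where
    open ≡-Reasoning
    one-minus : ∀ q x → + 1 + (- q) * x ≡ + 1 - q * x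
    one-minus = solve-∀

mainTheorem3 : (n : ℕ) → n ≥ 1 → (q : ℤ) →
    lhs n q ≡ qPoch q (- q) n * qfactPM n q
mainTheorem3 n _ q = begin
  lhs n q
    ≡⟨ ∑-filter (λ w → unique? (map ∣_∣ w)) (words (letters n) n) (wt q) ⟩
  ∑[ w ← words (letters n) n ] ⟦ uniqueAbs w ⟧ * wt q w
    ≡⟨ ∑-words-cong (letters n) (±letters (downFrom n)) (∑-letters n) n _ ⟩
  ∑[ w ← words (±letters (downFrom n)) n ] ⟦ uniqueAbs w ⟧ * wt q w
    ≡⟨ ∑-words-uniqueAbs n (downFrom n) (downFrom⁺ n) (Listᵖ.length-downFrom n) (wt q) ⟩
  ∑[ V ← signings (downFrom n) ] ∑ (arrangements n V) (wt q)
    ≡⟨ ∑-cong-∈ (signings (downFrom n)) arrangements-wt ⟩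
  ∑[ V ← signings (downFrom n) ] ∏ V (letterWeight q) * qfactPM n q
    ≡⟨ ∑-*ʳ (qfactPM n q) (signings (downFrom n)) (λ V → ∏ V (letterWeight q)) ⟩
  (∑[ V ← signings (downFrom n) ] ∏ V (letterWeight q)) * qfactPM n q
    ≡⟨ cong (_* qfactPM n q) (∑-signings-letterWeight q n) ⟩
  qPoch q (- q) n * qfactPM n q
    ∎
  where
  open ≡-Reasoning
  arrangements-wt : ∀ {V} → V ∈ signings (downFrom n) →
    ∑ (arrangements n V) (wt q) ≡ ∏ V (letterWeight q) * qfactPM n q
  arrangements-wt {V} V∈ = ∑-arrangements-wt q n V (All.lookup (signings-decreasing n) V∈)
    (trans (All.lookup (signings-length (downFrom n)) V∈) (Listᵖ.length-downFrom n))
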